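{- Let $k\geq 3$ be an integer and let $G$ be a connected graph of order $n\geq k^2$. If the minimum degree satisfies $\delta(G)\geq \frac{n-k+1}{k}$, then $G$ has at most $k-2$ cut edges.
   Context: All graphs are finite, simple and undirected; a cut edge is an edge whose removal disconnects the graph. -}

module Defs where

open import Data.Nat using (ℕ; zero; suc; _<_)
open import Data.Fin using (Fin; toℕ)
open import Data.Fin.Properties using (_≟_)
open import Data.Bool using (Bool; true; false)
open import Data.List using (List; []; _∷_; filterᵇ; length)
open import Data.List.Relation.Unary.All using (All)
open import Data.List.Relation.Unary.Unique.Propositional using (Unique)
open import Data.Product using (_×_; _,_; Σ)
open import Data.Vec.Functional using (Vector)
open import Data.List using (allFin)
open import Relation.Binary.PropositionalEquality using (_≡_; _≢_)
open import Relation.Nullary using (¬_)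

record Graph (n : ℕ) : Set where
  field
    adj   : Fin n → Fin n → Bool
    sym   : ∀ u v → adj u v ≡ adj v u
    irrefl : ∀ u → adj u u ≡ false
open Graph public

degree : ∀ {n} → Graph n → Fin n → ℕ
degree G u = length (filterᵇ (adj G u) (allFin _))

MinDegreeAtLeast : ∀ {n} → Graph n → ℕ → Set
MinDegreeAtLeast G d = ∀ u → d Data.Nat.≤ degree G u

data Walk {n : ℕ} (E : Fin n → Fin n → Set) : Fin n → Fin n → Set where
  here  : ∀ {u} → Walk E u u
  step  : ∀ {u v w} → E u v → Walk E v w → Walk E u w

Edge : ∀ {n} → Graph n → Fin n → Fin n → Set
Edge G u v = adj G u v ≡ true

Connected : ∀ {n} → Graph n → Set
Connected G = ∀ u v → Walk (Edge G) u v

EdgeWithout : ∀ {n} → Graph n → Fin n → Fin n → Fin n → Fin n → Set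
EdgeWithout G a b u v =
  Edge G u v × ¬ ((u ≡ a × v ≡ b) Data.Sum.⊎ (u ≡ b × v ≡ a))
  where import Data.Sum

-- {a,b} is a cut edge of a connected G: it is an edge and G - ab is disconnected
-- (equivalently for connected G: removing it increases the number of components).
CutEdge : ∀ {n} → Graph n → Fin n → Fin n → Set
CutEdge G a b = Edge G a b × ¬ (∀ u v → Walk (EdgeWithout G a b) u v)

-- A cut edge represented as an ordered pair (a , b) with a < b, so that each
-- unordered edge has exactly one representative.
IsCutEdgePair : ∀ {n} → Graph n → Fin n × Fin n → Set
IsCutEdgePair G (a , b) = (toℕ a < toℕ b) × CutEdge G a b

module Submission where

-- Suppose there are k - 1 distinct cut edges F.  Deleting them one at a time
-- splits the vertex set into k non-empty classes such that every edge of G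
-- outside F stays inside a class (a `Partition` of G along F): each deleted
-- cut edge ab divides its class into the vertices still reachable from a in
-- G - ab and the rest, which contains b.  Reachability is only needed inside
-- a proof of ⊥, so it may be assumed decidable (`¬¬-decide-all`).
--
-- Counting: a class X with s vertices has at least s (δ + 1 - s) ordered edges
-- leaving it (`boundary-lower`), all of them edges of F, hence at most |F| of
-- them (`boundary-upper`).  The hypotheses force k ≤ δ, so |F| < δ, and since
-- s (δ + 1 - s) ≥ δ whenever 1 ≤ s ≤ δ every class has more than δ vertices.
-- The k classes then give k (δ + 1) ≤ n, contradicting n + 1 - k ≤ k δ.

open import Defs hiding (sym)
open import Data.Nat using (ℕ; zero; suc; _+_; _*_; _∸_; _≤_; _<_; z≤n; s≤s; _≤?_)
open import Data.Nat.Properties hiding (_≟_)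
open import Data.Nat.ListAction using (sum)
open import Algebra.Properties.CommutativeSemigroup +-commutativeSemigroup using (interchange)
open import Data.Bool using (Bool; true; false; _∧_; not; if_then_else_)
open import Data.Bool.Properties using (T-≡)
open import Data.Fin using (Fin; zero; suc; _≟_; fromℕ<)
open import Data.List using (List; []; _∷_; filterᵇ; length; map; _++_; cartesianProduct; allFin; take)
open import Data.List.Properties using (length-tabulate; length-take)
open import Data.List.Membership.Propositional using (_∈_)
open import Data.List.Membership.Propositional.Properties using (∈-allFin; ∈-filter⁻)
import Data.List.Membership.DecPropositional as DecMembership
open import Data.List.Relation.Unary.All as All using (All; []; _∷_)
import Data.List.Relation.Unary.All.Properties as AllProps
open import Data.List.Relation.Unary.Any using (here; there)
open import Data.List.Relation.Unary.AllPairs using (_∷_)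
open import Data.List.Relation.Unary.Unique.Propositional using (Unique)
import Data.List.Relation.Unary.Unique.Propositional.Properties as UniqueProps
open import Data.Product using (_×_; _,_; proj₁; proj₂; ∃; swap)
open import Data.Product.Properties using (≡-dec)
open import Data.Sum as Sum using (_⊎_; inj₁; inj₂)
open import Data.Empty using (⊥; ⊥-elim)
open import Function using (_∘_; id)
open import Function.Bundles using (Equivalence; mk⇔)
open import Relation.Binary.Definitions using (DecidableEquality)
open import Relation.Binary.PropositionalEquality
open import Relation.Nullary using (¬_; Dec; yes; no; does; contradiction)
open import Relation.Nullary.Decidable
  using (_×-dec_; _⊎-dec_; ¬?; T?; dec-true; dec-false; does-⇔; decidable-stable; ¬¬-excluded-middle)

count : {A : Set} → (A → Bool) → List A → ℕ
count p xs = length (filterᵇ p xs)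

indicator : Bool → ℕ
indicator true  = 1
indicator false = 0

module _ {A : Set} where

  count-cons : (p : A → Bool) (x : A) (xs : List A) →
               count p (x ∷ xs) ≡ indicator (p x) + count p xs
  count-cons p x xs with p x
  ... | true  = refl
  ... | false = refl

  count-++ : (p : A → Bool) (xs ys : List A) → count p (xs ++ ys) ≡ count p xs + count p ys
  count-++ p []       ys = refl
  count-++ p (x ∷ xs) ys with p x
  ... | true  = cong suc (count-++ p xs ys)
  ... | false = count-++ p xs ys

  count-ext : (p q : A → Bool) → (∀ x → p x ≡ q x) → ∀ xs → count p xs ≡ count q xs
  count-ext p q p≗q []       = refl
  count-ext p q p≗q (x ∷ xs) = begin
    count p (x ∷ xs)                ≡⟨ count-cons p x xs ⟩
    indicator (p x) + count p xs    ≡⟨ cong₂ _+_ (cong indicator (p≗q x)) (count-ext p q p≗q xs) ⟩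
    indicator (q x) + count q xs    ≡⟨ count-cons q x xs ⟨
    count q (x ∷ xs)                ∎
    where open ≡-Reasoning

  count-all : (xs : List A) → count (λ _ → true) xs ≡ length xs
  count-all []       = refl
  count-all (x ∷ xs) = cong suc (count-all xs)

  count-split : (p q : A → Bool) (xs : List A) →
    count p xs ≡ count (λ x → p x ∧ q x) xs + count (λ x → p x ∧ not (q x)) xs
  count-split p q [] = refl
  count-split p q (x ∷ xs) with p x | q x
  ... | true  | true  = cong suc (count-split p q xs)
  ... | true  | false = trans (cong suc (count-split p q xs)) (sym (+-suc _ _))
  ... | false | _     = count-split p q xs

  count-mono : (p q : A → Bool) → (∀ x → p x ≡ true → q x ≡ true) →
               ∀ xs → count p xs ≤ count q xs
  count-mono p q p⇒q [] = z≤n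
  count-mono p q p⇒q (x ∷ xs) with p x in px | q x in qx
  ... | true  | true  = s≤s (count-mono p q p⇒q xs)
  ... | true  | false = contradiction (trans (sym (p⇒q x px)) qx) λ ()
  ... | false | true  = m≤n⇒m≤1+n (count-mono p q p⇒q xs)
  ... | false | false = count-mono p q p⇒q xs

  count-strict : (p q : A → Bool) → (∀ x → p x ≡ true → q x ≡ true) →
                 ∀ {y} xs → y ∈ xs → p y ≡ false → q y ≡ true → count p xs < count q xs
  count-strict p q p⇒q (x ∷ xs) (here refl) py qy rewrite py | qy = s≤s (count-mono p q p⇒q xs)
  count-strict p q p⇒q (x ∷ xs) (there y∈xs) py qy = begin-strict
    count p (x ∷ xs)               ≡⟨ count-cons p x xs ⟩
    indicator (p x) + count p xs   <⟨ +-mono-≤-< (indicator-mono (p⇒q x)) (count-strict p q p⇒q xs y∈xs py qy) ⟩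
    indicator (q x) + count q xs   ≡⟨ count-cons q x xs ⟨
    count q (x ∷ xs)               ∎
    where
    open ≤-Reasoning
    indicator-mono : ∀ {b c} → (b ≡ true → c ≡ true) → indicator b ≤ indicator c
    indicator-mono {false}          _   = z≤n
    indicator-mono {true}  {true}   _   = ≤-refl
    indicator-mono {true}  {false}  b⇒c = contradiction (b⇒c refl) λ ()

  count-pos : (p : A → Bool) → ∀ {y} xs → y ∈ xs → p y ≡ true → 0 < count p xs
  count-pos p (x ∷ xs) (here refl) py rewrite py = s≤s z≤n
  count-pos p (x ∷ xs) (there y∈xs) py = begin-strict
    0                              <⟨ count-pos p xs y∈xs py ⟩
    count p xs                     ≤⟨ m≤n+m _ (indicator (p x)) ⟩
    indicator (p x) + count p xs   ≡⟨ count-cons p x xs ⟨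
    count p (x ∷ xs)               ∎
    where open ≤-Reasoning

  count-≤1 : (p : A → Bool) → (∀ x y → p x ≡ true → p y ≡ true → x ≡ y) →
             ∀ xs → Unique xs → count p xs ≤ 1
  count-≤1 p unique-p [] _ = z≤n
  count-≤1 p unique-p (x ∷ xs) (x∉xs ∷ uxs) with p x in px
  ... | false = count-≤1 p unique-p xs uxs
  ... | true  = s≤s (≤-reflexive (none-pass xs x∉xs))
    where
    none-pass : ∀ ys → All (x ≢_) ys → count p ys ≡ 0
    none-pass []       []             = refl
    none-pass (y ∷ ys) (x≢y ∷ x∉ys) with p y in py
    ... | true  = ⊥-elim (x≢y (unique-p x y px py))
    ... | false = none-pass ys x∉ys

  sum-≥-count : (p : A → Bool) (g : A → ℕ) (c : ℕ) → (∀ x → p x ≡ true → c ≤ g x) →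
                ∀ xs → count p xs * c ≤ sum (map g xs)
  sum-≥-count p g c c≤g [] = z≤n
  sum-≥-count p g c c≤g (x ∷ xs) with p x in px
  ... | true  = +-mono-≤ (c≤g x px) (sum-≥-count p g c c≤g xs)
  ... | false = m≤n⇒m≤o+n (g x) (sum-≥-count p g c c≤g xs)

  sum-+ : (f g : A → ℕ) (xs : List A) →
          sum (map (λ x → f x + g x) xs) ≡ sum (map f xs) + sum (map g xs)
  sum-+ f g []       = refl
  sum-+ f g (x ∷ xs) =
    trans (cong (f x + g x +_) (sum-+ f g xs)) (interchange (f x) (g x) (sum (map f xs)) (sum (map g xs)))

  sum-ext : (f g : A → ℕ) → (∀ x → f x ≡ g x) → ∀ xs → sum (map f xs) ≡ sum (map g xs)
  sum-ext f g f≗g []       = refl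
  sum-ext f g f≗g (x ∷ xs) = cong₂ _+_ (f≗g x) (sum-ext f g f≗g xs)

  sum-indicator : (p : A → Bool) (xs : List A) → sum (map (indicator ∘ p) xs) ≡ count p xs
  sum-indicator p []       = refl
  sum-indicator p (x ∷ xs) = trans (cong (indicator (p x) +_) (sum-indicator p xs)) (sym (count-cons p x xs))

count-map : {A B : Set} (p : B → Bool) (f : A → B) (xs : List A) →
            count p (map f xs) ≡ count (p ∘ f) xs
count-map p f []       = refl
count-map p f (x ∷ xs) with p (f x)
... | true  = cong suc (count-map p f xs)
... | false = count-map p f xs

module _ {A B : Set} where

  count-cartesian : (p : A × B → Bool) (xs : List A) (ys : List B) →
    count p (cartesianProduct xs ys) ≡ sum (map (λ x → count (λ y → p (x , y)) ys) xs)
  count-cartesian p []       ys = refl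
  count-cartesian p (x ∷ xs) ys =
    trans (count-++ p (map (x ,_) ys) (cartesianProduct xs ys))
          (cong₂ _+_ (count-map p (x ,_) ys) (count-cartesian p xs ys))

  sum-class-sizes : (_≟ᴮ_ : DecidableEquality B) (cls : A → B) (cs : List B) → Unique cs →
    (xs : List A) → sum (map (λ c → count (λ x → does (cls x ≟ᴮ c)) xs) cs) ≤ length xs
  sum-class-sizes _≟ᴮ_ cls cs ucs [] = ≤-reflexive (all-zero cs)
    where
    all-zero : ∀ cs → sum (map (λ c → count (λ x → does (cls x ≟ᴮ c)) []) cs) ≡ 0
    all-zero []       = refl
    all-zero (_ ∷ cs) = all-zero cs
  sum-class-sizes _≟ᴮ_ cls cs ucs (x ∷ xs) = begin
    sum (map (λ c → size c (x ∷ xs)) cs)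
      ≡⟨ sum-ext _ _ (λ c → count-cons (λ y → does (cls y ≟ᴮ c)) x xs) cs ⟩
    sum (map (λ c → indicator (in-class x c) + size c xs) cs)
      ≡⟨ sum-+ (indicator ∘ in-class x) (λ c → size c xs) cs ⟩
    sum (map (indicator ∘ in-class x) cs) + sum (map (λ c → size c xs) cs)
      ≡⟨ cong (_+ sum (map (λ c → size c xs) cs)) (sum-indicator (in-class x) cs) ⟩
    count (in-class x) cs + sum (map (λ c → size c xs) cs)
      ≤⟨ +-mono-≤ (count-≤1 (in-class x) one-class cs ucs) (sum-class-sizes _≟ᴮ_ cls cs ucs xs) ⟩
    suc (length xs) ∎
    where
    open ≤-Reasoning
    in-class : A → B → Bool
    in-class y c = does (cls y ≟ᴮ c)
    size : B → List A → ℕ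
    size c ys = count (λ y → in-class y c) ys
    class-of : ∀ {c} → in-class x c ≡ true → cls x ≡ c
    class-of {c} _ with cls x ≟ᴮ c
    ... | yes eq = eq
    one-class : ∀ c d → in-class x c ≡ true → in-class x d ≡ true → c ≡ d
    one-class c d xc xd = trans (sym (class-of xc)) (class-of xd)

  length-≤-by-injection : (f : A → B) (xs : List A) (ys : List B) → Unique xs →
    (∀ {x y} → x ∈ xs → y ∈ xs → f x ≡ f y → x ≡ y) →
    (∀ {x} → x ∈ xs → f x ∈ ys) → length xs ≤ length ys
  length-≤-by-injection f [] ys _ _ _ = z≤n
  length-≤-by-injection f (x ∷ xs) ys (x∉xs ∷ uxs) injective into =
    subst (suc (length xs) ≤_) (length-remove ys fx∈ys)
      (s≤s (length-≤-by-injection f xs (remove ys fx∈ys) uxs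
              (λ y∈ z∈ → injective (there y∈) (there z∈))
              (λ y∈xs → remove-keeps ys fx∈ys (into (there y∈xs)) (fy≢fx y∈xs))))
    where
    fx∈ys = into (here refl)
    fy≢fx : ∀ {y} → y ∈ xs → f y ≢ f x
    fy≢fx y∈xs fy≡fx = All.lookup x∉xs y∈xs (sym (injective (there y∈xs) (here refl) fy≡fx))

    remove : (zs : List B) {z : B} → z ∈ zs → List B
    remove (_ ∷ zs) (here _)  = zs
    remove (z ∷ zs) (there p) = z ∷ remove zs p

    length-remove : (zs : List B) {z : B} (p : z ∈ zs) → suc (length (remove zs p)) ≡ length zs
    length-remove (_ ∷ zs) (here _)  = refl
    length-remove (z ∷ zs) (there p) = cong suc (length-remove zs p)

    remove-keeps : (zs : List B) {z w : B} (p : z ∈ zs) → w ∈ zs → w ≢ z → w ∈ remove zs p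
    remove-keeps (_ ∷ zs) (here refl) (here refl) w≢z = ⊥-elim (w≢z refl)
    remove-keeps (_ ∷ zs) (here refl) (there q)   _   = q
    remove-keeps (_ ∷ zs) (there p)   (here refl) _   = here refl
    remove-keeps (_ ∷ zs) (there p)   (there q)   w≢z = there (remove-keeps zs p q w≢z)

-- For 1 ≤ s ≤ d:  d ≤ s (d + 1 - s)  (the product is concave in s and
-- equals d at both ends).
d≤s*[d+1-s] : ∀ s d → 1 ≤ s → s ≤ d → d ≤ s * (suc d ∸ s)
d≤s*[d+1-s] s d 1≤s s≤d with m≤n⇒∃[o]m+o≡n s≤d
... | r , refl = begin
  s + r                  ≡⟨ cong (s +_) (*-identityˡ r) ⟨
  s + 1 * r              ≤⟨ +-monoʳ-≤ s (*-monoˡ-≤ r 1≤s) ⟩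
  s + s * r              ≡⟨ *-suc s r ⟨
  s * suc r              ≡⟨ cong (s *_) (sym (trans (+-∸-assoc 1 (m≤m+n s r)) (cong suc (m+n∸m≡n s r)))) ⟩
  s * (suc (s + r) ∸ s)  ∎
  where open ≤-Reasoning

order-too-small : ∀ k n δ → n + 1 ∸ k ≤ k * δ → ¬ (k * suc δ ≤ n)
order-too-small k n δ hyp k[δ+1]≤n = n≮n (k * δ) (begin-strict
  k * δ               <⟨ n<1+n (k * δ) ⟩
  suc (k * δ)         ≡⟨ +-comm 1 (k * δ) ⟩
  k * δ + 1           ≡⟨ m+n∸m≡n k (k * δ + 1) ⟨
  k + (k * δ + 1) ∸ k ≡⟨ cong (_∸ k) (+-assoc k (k * δ) 1) ⟨
  k + k * δ + 1 ∸ k   ≡⟨ cong (λ m → m + 1 ∸ k) (*-suc k δ) ⟨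
  k * suc δ + 1 ∸ k   ≤⟨ ∸-monoˡ-≤ k (+-monoˡ-≤ 1 k[δ+1]≤n) ⟩
  n + 1 ∸ k           ≤⟨ hyp ⟩
  k * δ               ∎)
  where open ≤-Reasoning

k≤δ : ∀ k n δ → k * k ≤ n → n + 1 ∸ k ≤ k * δ → k ≤ δ
k≤δ k n δ k²≤n hyp with k ≤? δ
... | yes k≤δ = k≤δ
... | no  k≰δ = ⊥-elim (order-too-small k n δ hyp (≤-trans (*-monoʳ-≤ k (≰⇒> k≰δ)) k²≤n))

module _ {n : ℕ} {E : Fin n → Fin n → Set} where

  _▷_ : ∀ {u v w} → Walk E u v → E v w → Walk E u w
  here       ▷ e = step e here
  step e′ p  ▷ e = step e′ (p ▷ e)

  _++ᵂ_ : ∀ {u v w} → Walk E u v → Walk E v w → Walk E u w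
  here     ++ᵂ q = q
  step e p ++ᵂ q = step e (p ++ᵂ q)

  reverse : (∀ {x y} → E x y → E y x) → ∀ {u v} → Walk E u v → Walk E v u
  reverse sym-E here       = here
  reverse sym-E (step e p) = reverse sym-E p ▷ sym-E e

¬¬-decide-all : ∀ {m} {P : Fin m → Set} → ¬ ¬ (∀ v → Dec (P v))
¬¬-decide-all {zero}      given = given (λ ())
¬¬-decide-all {suc m} {P} given = ¬¬-excluded-middle λ P0? →
  ¬¬-decide-all {m} {P ∘ suc} λ rest? → given λ { zero → P0? ; (suc i) → rest? i }

module _ {n : ℕ} (G : Graph n) where

  Pair : Set
  Pair = Fin n × Fin n

  Listed : List Pair → Fin n → Fin n → Set
  Listed F u v = (u , v) ∈ F ⊎ (v , u) ∈ F

  open DecMembership {A = Pair} (≡-dec _≟_ _≟_) using (_∈?_)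

  listed? : ∀ F u v → Dec (Listed F u v)
  listed? F u v = ((u , v) ∈? F) ⊎-dec ((v , u) ∈? F)

  without-sym : ∀ {a b u v} → EdgeWithout G a b u v → EdgeWithout G a b v u
  without-sym {u = u} {v} (uv , not-ab) = trans (Graph.sym G v u) uv ,
    λ { (inj₁ (p , q)) → not-ab (inj₂ (q , p)) ; (inj₂ (p , q)) → not-ab (inj₁ (q , p)) }

  reroute : ∀ {a b} → Walk (EdgeWithout G a b) a b →
            ∀ {u v} → Walk (Edge G) u v → Walk (EdgeWithout G a b) u v
  reroute a~b here = here
  reroute {a} {b} a~b (step {u} {x} e p) with (u ≟ a ×-dec x ≟ b) ⊎-dec (u ≟ b ×-dec x ≟ a)
  ... | yes (inj₁ (refl , refl)) = a~b ++ᵂ reroute a~b p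
  ... | yes (inj₂ (refl , refl)) = reverse without-sym a~b ++ᵂ reroute a~b p
  ... | no  not-ab               = step (e , not-ab) (reroute a~b p)

  cut-edge-separates : Connected G → ∀ {a b} → CutEdge G a b → ¬ Walk (EdgeWithout G a b) a b
  cut-edge-separates conn (_ , disconnected) a~b = disconnected λ u v → reroute a~b (conn u v)

  module Boundary (X : Fin n → Bool) where

    size : ℕ
    size = count X (allFin n)

    leaves : Pair → Bool
    leaves (v , w) = X v ∧ (adj G v w ∧ not (X w))

    boundary : List Pair
    boundary = filterᵇ leaves (cartesianProduct (allFin n) (allFin n))

    leaves-spec : ∀ {v w} → leaves (v , w) ≡ true → X v ≡ true × Edge G v w × X w ≡ false
    leaves-spec {v} {w} e with X v | adj G v w | X w
    leaves-spec refl | true  | true  | false = refl , refl , refl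
    leaves-spec ()   | true  | true  | true
    leaves-spec ()   | true  | false | _
    leaves-spec ()   | false | _     | _

    leaves-asym : ∀ {p} → leaves p ≡ true → leaves (swap p) ≡ true → ⊥
    leaves-asym vw wv with leaves-spec vw | leaves-spec wv
    ... | _ , _ , w∉X | w∈X , _ , _ = contradiction (trans (sym w∉X) w∈X) λ ()

    in-boundary : ∀ {p} → p ∈ boundary → leaves p ≡ true
    in-boundary p∈ = Equivalence.to T-≡
      (proj₂ (∈-filter⁻ (T? ∘ leaves) {xs = cartesianProduct (allFin n) (allFin n)} p∈))

    -- Each v ∈ X has fewer than |X| neighbours in X, so at least
    -- δ + 1 - |X| outside; summing over X gives  |X| (δ + 1 - |X|).
    boundary-lower : ∀ {δ} → MinDegreeAtLeast G δ → size * (suc δ ∸ size) ≤ length boundary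
    boundary-lower {δ} minδ = begin
      size * (suc δ ∸ size)                ≤⟨ sum-≥-count X out-degree (suc δ ∸ size) many-out (allFin n) ⟩
      sum (map out-degree (allFin n))      ≡⟨ count-cartesian leaves (allFin n) (allFin n) ⟨
      length boundary                      ∎
      where
      open ≤-Reasoning
      out-degree : Fin n → ℕ
      out-degree v = count (λ w → leaves (v , w)) (allFin n)

      many-out : ∀ v → X v ≡ true → suc δ ∸ size ≤ out-degree v
      many-out v v∈X = begin
        suc δ ∸ size              ≤⟨ ∸-monoˡ-≤ size (≤-trans (s≤s δ≤in+out) (+-monoˡ-≤ outside in<size)) ⟩
        size + outside ∸ size     ≡⟨ m+n∸m≡n size outside ⟩
        outside                   ≡⟨ count-ext _ _ (λ w → cong (_∧ (adj G v w ∧ not (X w))) (sym v∈X)) (allFin n) ⟩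
        out-degree v              ∎
        where
        inside  = count (λ w → adj G v w ∧ X w) (allFin n)
        outside = count (λ w → adj G v w ∧ not (X w)) (allFin n)
        δ≤in+out : δ ≤ inside + outside
        δ≤in+out = subst (δ ≤_) (count-split (adj G v) X (allFin n)) (minδ v)
        -- v itself is in X but is not its own neighbour
        in<size : inside < size
        in<size = count-strict _ X (λ w e → ∧-right (adj G v w) e) (allFin n) (∈-allFin v)
                    (cong (_∧ X v) (Graph.irrefl G v)) v∈X
          where ∧-right : ∀ a {b} → a ∧ b ≡ true → b ≡ true
                ∧-right true e = e

    -- If every edge leaving X is listed in F, orienting each boundary pair
    -- as it appears in F is injective, so there are at most |F| of them.
    boundary-upper : (F : List Pair) →
      (∀ v w → Edge G v w → X v ≡ true → X w ≡ false → Listed F v w) →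
      length boundary ≤ length F
    boundary-upper F leaving-listed =
      length-≤-by-injection orient boundary F
        (UniqueProps.filter⁺ (T? ∘ leaves)
          (UniqueProps.cartesianProduct⁺ (UniqueProps.allFin⁺ n) (UniqueProps.allFin⁺ n)))
        (λ p∈ q∈ → orient-injective (in-boundary p∈) (in-boundary q∈))
        (λ p∈ → orient-in-F (in-boundary p∈))
      where
      orient : Pair → Pair
      orient p with p ∈? F
      ... | yes _ = p
      ... | no  _ = swap p

      orient-cases : ∀ p → orient p ≡ p ⊎ orient p ≡ swap p
      orient-cases p with p ∈? F
      ... | yes _ = inj₁ refl
      ... | no  _ = inj₂ refl

      orient-in-F : ∀ {p} → leaves p ≡ true → orient p ∈ F
      orient-in-F {v , w} vw with (v , w) ∈? F
      ... | yes vw∈F = vw∈F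
      ... | no  vw∉F with leaves-spec vw
      ...   | v∈X , e , w∉X = Sum.[ (λ vw∈F → ⊥-elim (vw∉F vw∈F)) , id ] (leaving-listed v w e v∈X w∉X)

      orient-injective : ∀ {p q} → leaves p ≡ true → leaves q ≡ true → orient p ≡ orient q → p ≡ q
      orient-injective {p} {q} lp lq eq with orient-cases p | orient-cases q
      ... | inj₁ op | inj₁ oq = trans (sym op) (trans eq oq)
      ... | inj₂ op | inj₂ oq = cong swap (trans (sym op) (trans eq oq))
      ... | inj₁ op | inj₂ oq = ⊥-elim (leaves-asym lq (subst (λ r → leaves r ≡ true) (trans (sym op) (trans eq oq)) lp))
      ... | inj₂ op | inj₁ oq = ⊥-elim (leaves-asym lp (subst (λ r → leaves r ≡ true) (sym (trans (sym op) (trans eq oq))) lq))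

    large-when-few-leave : ∀ {δ} → MinDegreeAtLeast G δ → 0 < size → (F : List Pair) →
      (∀ v w → Edge G v w → X v ≡ true → X w ≡ false → Listed F v w) →
      length F < δ → suc δ ≤ size
    large-when-few-leave {δ} minδ nonempty F leaving-listed |F|<δ with suc δ ≤? size
    ... | yes large = large
    ... | no  small = ⊥-elim (<-irrefl refl (begin-strict
      δ                        ≤⟨ d≤s*[d+1-s] size δ nonempty (≤-pred (≰⇒> small)) ⟩
      size * (suc δ ∸ size)    ≤⟨ boundary-lower minδ ⟩
      length boundary          ≤⟨ boundary-upper F leaving-listed ⟩
      length F                 <⟨ |F|<δ ⟩
      δ                        ∎))
      where open ≤-Reasoning

  record Partition (F : List Pair) : Set where
    field
      label      : Fin n → Fin (suc (length F))
      surjective : ∀ c → ∃ λ v → label v ≡ c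
      respects   : ∀ u v → Edge G u v → ¬ Listed F u v → label u ≡ label v

    class : Fin (suc (length F)) → Fin n → Bool
    class c v = does (label v ≟ c)

  trivial : Fin n → Partition []
  trivial v₀ = record
    { label      = λ _ → zero
    ; surjective = λ { zero → v₀ , refl }
    ; respects   = λ _ _ _ _ → refl
    }

  module Split (conn : Connected G) {F : List Pair} (P : Partition F) {a b : Fin n}
               (cut : CutEdge G a b) (fresh : ¬ Listed F a b)
               (reach? : ∀ v → Dec (Walk (EdgeWithout G a b) a v)) where
    open Partition P

    SplitOff : Fin n → Set
    SplitOff v = label v ≡ label a × ¬ Walk (EdgeWithout G a b) a v

    split-off? : ∀ v → Dec (SplitOff v)
    split-off? v = (label v ≟ label a) ×-dec ¬? (reach? v)

    label′ : Fin n → Fin (suc (suc (length F)))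
    label′ v = if does (split-off? v) then zero else suc (label v)

    label′-split-off : ∀ {v} → SplitOff v → label′ v ≡ zero
    label′-split-off {v} off rewrite dec-true (split-off? v) off = refl

    label′-kept : ∀ {v} → ¬ SplitOff v → label′ v ≡ suc (label v)
    label′-kept {v} kept rewrite dec-false (split-off? v) kept = refl

    surjective′ : ∀ c → ∃ λ v → label′ v ≡ c
    surjective′ zero = b , label′-split-off (sym (respects a b (proj₁ cut) fresh) , cut-edge-separates conn cut)
    surjective′ (suc c) with c ≟ label a
    ... | yes refl = a , label′-kept (λ (_ , unreachable) → unreachable here)
    ... | no  c≢a with surjective c
    ...   | v , refl = v , label′-kept (λ (same , _) → c≢a same)

    split-off-along : ∀ {u v} → EdgeWithout G a b u v → label u ≡ label v → SplitOff u → SplitOff v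
    split-off-along uv same (in-a , unreachable) =
      trans (sym same) in-a , λ a~v → unreachable (a~v ▷ without-sym uv)

    respects′ : ∀ u v → Edge G u v → ¬ Listed ((a , b) ∷ F) u v → label′ u ≡ label′ v
    respects′ u v e unlisted =
      cong₂ (λ off l → if off then zero else suc l)
        (does-⇔ (mk⇔ (split-off-along uv same) (split-off-along (without-sym uv) (sym same)))
                (split-off? u) (split-off? v))
        same
      where
      same : label u ≡ label v
      same = respects u v e (unlisted ∘ Sum.map there there)
      uv : EdgeWithout G a b u v
      uv = e , λ { (inj₁ (refl , refl)) → unlisted (inj₁ (here refl))
                 ; (inj₂ (refl , refl)) → unlisted (inj₂ (here refl)) }

    partition : Partition ((a , b) ∷ F)
    partition = record { label = label′ ; surjective = surjective′ ; respects = respects′ }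

  ¬¬-partition : Connected G → Fin n → ∀ F → Unique F → All (IsCutEdgePair G) F → ¬ ¬ Partition F
  ¬¬-partition conn v₀ [] _ _ none = none (trivial v₀)
  ¬¬-partition conn v₀ ((a , b) ∷ F) (ab∉F ∷ unique-F) ((a<b , cut) ∷ cuts-F) none =
    ¬¬-partition conn v₀ F unique-F cuts-F λ P →
    ¬¬-decide-all λ reach? → none (Split.partition conn P cut fresh reach?)
    where
    fresh : ¬ Listed F a b
    fresh (inj₁ ab∈F) = All.lookup ab∉F ab∈F refl
    fresh (inj₂ ba∈F) = <-asym a<b (proj₁ (All.lookup cuts-F ba∈F))

  classes-large : ∀ {δ F} → MinDegreeAtLeast G δ → length F < δ → (P : Partition F) →
                  ∀ c → suc δ ≤ Boundary.size (Partition.class P c)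
  classes-large {δ} {F} minδ |F|<δ P c =
    Boundary.large-when-few-leave (class c) minδ nonempty F leaving-listed |F|<δ
    where
    open Partition P
    nonempty : 0 < Boundary.size (class c)
    nonempty with surjective c
    ... | v , label-v = count-pos (class c) (allFin n) (∈-allFin v) (dec-true (label v ≟ c) label-v)

    leaving-listed : ∀ v w → Edge G v w → class c v ≡ true → class c w ≡ false → Listed F v w
    leaving-listed v w e v∈c w∉c with listed? F v w | label v ≟ c | label w ≟ c
    ... | yes listed | _        | _        = listed
    ... | no unlisted | yes refl | no w≢c  = ⊥-elim (w≢c (sym (respects v w e unlisted)))
    leaving-listed v w e () w∉c | no _ | no _ | _
    leaving-listed v w e v∈c () | no _ | _ | yes _

  classes-cover : ∀ {m d} (label : Fin n → Fin m) →
    (∀ c → d ≤ count (λ v → does (label v ≟ c)) (allFin n)) → m * d ≤ n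
  classes-cover {m} {d} label large = begin
    m * d                                   ≡⟨ cong (_* d) (length-tabulate {n = m} id) ⟨
    length (allFin m) * d                   ≡⟨ cong (_* d) (count-all (allFin m)) ⟨
    count (λ _ → true) (allFin m) * d       ≤⟨ sum-≥-count _ (λ c → count (λ v → does (label v ≟ c)) (allFin n)) d (λ c _ → large c) (allFin m) ⟩
    sum (map (λ c → count (λ v → does (label v ≟ c)) (allFin n)) (allFin m))
                                            ≤⟨ sum-class-sizes _≟_ label (allFin m) (UniqueProps.allFin⁺ m) (allFin n) ⟩
    length (allFin n)                       ≡⟨ length-tabulate {n = n} id ⟩
    n                                       ∎
    where open ≤-Reasoning

  cut-edges-force-order : Connected G → Fin n → ∀ {δ} → MinDegreeAtLeast G δ →
    ∀ F → Unique F → All (IsCutEdgePair G) F → length F < δ → suc (length F) * suc δ ≤ n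
  cut-edges-force-order conn v₀ minδ F unique-F cuts-F |F|<δ =
    decidable-stable (_ ≤? n) λ too-small →
    ¬¬-partition conn v₀ F unique-F cuts-F λ P →
    too-small (classes-cover (Partition.label P) (classes-large minδ |F|<δ P))

theorem3p1 : (k n : ℕ) → 3 ≤ k → k * k ≤ n → (G : Graph n) → Connected G →
    (δ : ℕ) → MinDegreeAtLeast G δ → n + 1 ∸ k ≤ k * δ →
    (cuts : List (Fin n × Fin n)) → Unique cuts → All (IsCutEdgePair G) cuts →
    length cuts ≤ k ∸ 2
theorem3p1 k n (s≤s (s≤s (s≤s _))) k²≤n G conn δ minδ hyp cuts unique-cuts all-cut
  with length cuts ≤? k ∸ 2
... | yes few = few
... | no  many = ⊥-elim (order-too-small k n δ hyp k[δ+1]≤n)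
  where
  F = take (k ∸ 1) cuts
  |F|≡k-1 : length F ≡ k ∸ 1
  |F|≡k-1 = trans (length-take (k ∸ 1) cuts) (m≤n⇒m⊓n≡m (≰⇒> many))
  v₀ : Fin n
  v₀ = fromℕ< (≤-trans (s≤s z≤n) k²≤n)
  |F|<δ : length F < δ
  |F|<δ = subst (_< δ) (sym |F|≡k-1) (k≤δ k n δ k²≤n hyp)
  k[δ+1]≤n : k * suc δ ≤ n
  k[δ+1]≤n = subst (λ m → suc m * suc δ ≤ n) |F|≡k-1
    (cut-edges-force-order G conn v₀ minδ F (UniqueProps.take⁺ (k ∸ 1) unique-cuts)
                           (AllProps.take⁺ (k ∸ 1) all-cut) |F|<δ)
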